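{- Let $n\ge2$ and let $G=\{G_1,\ldots,G_t\}\subseteq\mathrm{H}(n,\mathbb{Q}(\mathrm{i}))$ be a finite set in which every $G_i$ is non-redundant. Suppose there exist $M_1,M_2,M_3,M_4\in G$ such that $[M_1,M_2]$ and $[M_3,M_4]$ do not have the same angle. Then $\bm{I}_n\in\langle G\rangle$.
   Context: $\mathbb{Q}(\mathrm{i})=\{a+b\mathrm{i}: a,b\in\mathbb{Q}\}$. $\mathrm{H}(n,\mathbb{Q}(\mathrm{i}))$ is the set of $n\times n$ matrices $M=\begin{pmatrix}1&\bm{m}_1^T&m_3\\ \bm{0}&\bm{I}_{n-2}&\bm{m}_2\\ 0&\bm{0}^T&1\end{pmatrix}$ with $\bm{m}_1,\bm{m}_2\in\mathbb{Q}(\mathrm{i})^{n-2}$, $m_3\in\mathbb{Q}(\mathrm{i})$; write $\psi(M)=(\bm{m}_1,\bm{m}_2,m_3)$. $\Omega$ is the set of such matrices with $\bm{m}_1=\bm{m}_2=\bm{0}$. $\langle G\rangle$ is the semigroup of all non-empty finite products of elements of $G$. A matrix $G_i\in G$ is non-redundant if it occurs in some product of elements of $G$ that lies in $\Omega$ (equivalently: writing $\psi(G_j)=(\bm{a}_j,\bm{b}_j,c_j)$, the system $\sum_j x_j\bm{a}_j=\bm{0}$, $\sum_j x_j\bm{b}_j=\bm{0}$ has a solution $\bm{x}\in\mathbb{N}^t$ with $x_i\ge1$). The commutator of $M_1,M_2$ with $\psi(M_k)=(\bm{a}_k,\bm{b}_k,c_k)$ is the scalar $[M_1,M_2]=\bm{a}_1^T\bm{b}_2-\bm{a}_2^T\bm{b}_1\in\mathbb{Q}(\mathrm{i})$.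 Its angle is the $\gamma\in[0,\pi)$ with $[M_1,M_2]=r\exp(\mathrm{i}\gamma)$ for some real $r$. Two commutators have the same angle if they can be written as $r\exp(\mathrm{i}\gamma)$ and $r'\exp(\mathrm{i}\gamma)$ with $r,r'\in\mathbb{R}$ and the same $\gamma$; by convention, a zero commutator has the same angle as every commutator. Thus "not the same angle" means both commutators are non-zero with different angles in $[0,\pi)$. -}

module Defs where

open import Data.Nat using (ℕ; zero; suc)
open import Data.Fin using (Fin; zero; suc; inject₁; fromℕ; _≟_)
open import Data.Rational using (ℚ; 0ℚ; 1ℚ) renaming (_+_ to _+q_; _*_ to _*q_; _-_ to _-q_)
open import Data.List using (List)
open import Data.List.NonEmpty using (List⁺; _∷_; toList; map)
open import Data.List.Membership.Propositional using (_∈_)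
open import Data.Product using (_×_; Σ-syntax)
open import Data.Sum using (_⊎_)
open import Relation.Nullary using (¬_; yes; no)
open import Relation.Binary.PropositionalEquality using (_≡_)

record ℚi : Set where
  constructor cplx
  field
    re : ℚ
    im : ℚ
open ℚi public

0ᵢ 1ᵢ : ℚi
0ᵢ = cplx (0ℚ) (0ℚ)
1ᵢ = cplx (1ℚ) (0ℚ)

_+ᵢ_ : ℚi → ℚi → ℚi
(cplx a b) +ᵢ (cplx c d) = cplx ((a +q c)) ((b +q d))

_-ᵢ_ : ℚi → ℚi → ℚi
(cplx a b) -ᵢ (cplx c d) = cplx ((a -q c)) ((b -q d))

_*ᵢ_ : ℚi → ℚi → ℚi
(cplx a b) *ᵢ (cplx c d) = cplx (((a *q c) -q (b *q d))) (((a *q d) +q (b *q c)))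

sumFin : (m : ℕ) → (Fin m → ℚi) → ℚi
sumFin zero    f = 0ᵢ
sumFin (suc m) f = f zero +ᵢ sumFin m (λ j → f (suc j))

Mat : ℕ → Set
Mat n = Fin n → Fin n → ℚi

_≈M_ : ∀ {n} → Mat n → Mat n → Set
A ≈M B = ∀ i j → A i j ≡ B i j

_*M_ : ∀ {n} → Mat n → Mat n → Mat n
_*M_ {n} A B i j = sumFin n (λ l → A i l *ᵢ B l j)

Iₙ : ∀ {n} → Mat n
Iₙ i j with i ≟ j
... | yes _ = 1ᵢ
... | no  _ = 0ᵢ

prodList : ∀ {n} → Mat n → List (Mat n) → Mat n
prodList M List.[] = M
prodList M (N List.∷ Ns) = M *M prodList N Ns

prod⁺ : ∀ {n} → List⁺ (Mat n) → Mat n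
prod⁺ (M ∷ Ms) = prodList M Ms

-- Heisenberg matrices H(n, ℚ(i)) with n = k + 2.
-- Index 0 is the first row/column, `lastI k` the last one and
-- `mid j` (j : Fin k) the middle ones.

lastI : (k : ℕ) → Fin (suc (suc k))
lastI k = fromℕ (suc k)

mid : ∀ {k} → Fin k → Fin (suc (suc k))
mid j = suc (inject₁ j)

-- positions allowed to differ from the identity matrix:
-- row 0 off the diagonal (m₁ and m₃), last column off the diagonal (m₂ and m₃)
Free : (k : ℕ) → Fin (suc (suc k)) → Fin (suc (suc k)) → Set
Free k i j = (i ≡ zero × ¬ j ≡ zero) ⊎ (j ≡ lastI k × ¬ i ≡ lastI k)

IsH : (k : ℕ) → Mat (suc (suc k)) → Set
IsH k M = ∀ i j → ¬ Free k i j → M i j ≡ Iₙ i j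

ψ₁ : ∀ {k} → Mat (suc (suc k)) → Fin k → ℚi
ψ₁ M j = M zero (mid j)

ψ₂ : ∀ {k} → Mat (suc (suc k)) → Fin k → ℚi
ψ₂ {k} M j = M (mid j) (lastI k)

ψ₃ : ∀ {k} → Mat (suc (suc k)) → ℚi
ψ₃ {k} M = M zero (lastI k)

InΩ : (k : ℕ) → Mat (suc (suc k)) → Set
InΩ k M = IsH k M × (∀ j → ψ₁ M j ≡ 0ᵢ) × (∀ j → ψ₂ M j ≡ 0ᵢ)

-- A finite set G = {G₁,…,Gₜ} is given as a family G : Fin t → Mat n.

In⟨_⟩ : ∀ {n t} → (Fin t → Mat n) → Mat n → Set
In⟨_⟩ {n} {t} G M = Σ[ w ∈ List⁺ (Fin t) ] (prod⁺ (map G w) ≈M M)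

NonRedundant : ∀ {k t} → (Fin t → Mat (suc (suc k))) → Fin t → Set
NonRedundant {k} {t} G i =
  Σ[ w ∈ List⁺ (Fin t) ] (i ∈ toList w × InΩ k (prod⁺ (map G w)))

dot : ∀ {k} → (Fin k → ℚi) → (Fin k → ℚi) → ℚi
dot {k} a b = sumFin k (λ j → a j *ᵢ b j)

comm : ∀ {k} → Mat (suc (suc k)) → Mat (suc (suc k)) → ℚi
comm M₁ M₂ = dot (ψ₁ M₁) (ψ₂ M₂) -ᵢ dot (ψ₁ M₂) (ψ₂ M₁)

-- z and w have the same angle: z = r e^{iγ}, w = r' e^{iγ} with r, r' real
-- (zero has the same angle as everything).  This holds iff z and w are
-- ℝ-linearly dependent, i.e. Re z · Im w − Im z · Re w = 0.
SameAngle : ℚi → ℚi → Set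
SameAngle z w = (re z *q im w) -q (im z *q re w) ≡ 0ℚ

module Submission where

-- Write an element of H(n, ℚ(i)) as its triple ψ = (m₁, m₂, m₃); matrix product becomes
-- (m₁, m₂, m₃)(m₁′, m₂′, m₃′) = (m₁ + m₁′, m₂ + m₂′, m₃ + m₃′ + m₁ᵀm₂′), and Ω is the centre {m₁ = m₂ = 0}.
-- If x ∈ G is non-redundant, rotating a word in Ω that contains x yields X ∈ ⟨G⟩ with xX ∈ Ω, i.e. an
-- inverse of x modulo the centre. For two such generators x, y the product xⁿyⁿXⁿYⁿ is the commutator of
-- xⁿ and yⁿ times the central elements (xX)ⁿ, (yY)ⁿ, so it lies in Ω with corner n(u_x + u_y) + n²[x, y],
-- where u_x is the corner of xX; exchanging x and y changes the sign of the n² term. Corners of products in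
-- Ω add up, so the corners of ⟨G⟩ ∩ Ω form an additive semigroup containing n u₁ ± n² δ₁ and n u₂ ± n² δ₂
-- for all n ≥ 1, where δ₁ = [M₁, M₂] and δ₂ = [M₃, M₄]. Having different angles, δ₁ and δ₂ form a ℚ-basis
-- of ℚ(i), so after clearing denominators (1 + e)(u₁ + u₂) = a δ₁ + b δ₂ with integers a, b and e ∈ ℕ;
-- for n large this yields a vanishing combination of the four families with positive integer
-- multiplicities, i.e. a product of elements of G in Ω with corner 0, which is Iₙ.

open import Defs
open import Level using (0ℓ)
open import Function using (_∘_)
open import Data.Empty using (⊥-elim)
open import Data.Product using (_×_; _,_; proj₁; proj₂; Σ-syntax; ∃-syntax)
open import Data.Sum using (_⊎_; inj₁; inj₂)
open import Data.Nat as ℕ using (ℕ; zero; suc)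
import Data.Nat.Properties as ℕ
open import Data.Integer as ℤ using (ℤ; -[1+_])
import Data.Integer.Properties as ℤ
open import Data.Rational as Q using (ℚ; mkℚ; 0ℚ; 1ℚ; toℚᵘ)
import Data.Rational.Properties as Q
open import Data.Rational.Unnormalised as Qᵘ using (mkℚᵘ; *≡*)
import Data.Rational.Unnormalised.Properties as Qᵘ
open import Data.Fin using (Fin; zero; suc; _≟_)
open import Data.Fin.Properties using (suc-injective; inject₁-injective; fromℕ≢inject₁)
open import Data.List using (List; []; _∷_; _++_)
import Data.List as List
open import Data.List.NonEmpty using (List⁺; _∷_; toList; _⁺++⁺_; _⁺++_)
open import Data.List.Membership.Propositional.Properties using (∈-∃++)
open import Relation.Nullary using (¬_; Dec; yes; no)
open import Relation.Nullary.Decidable using (dec⇒maybe)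
open import Relation.Binary.PropositionalEquality
open ≡-Reasoning
open import Algebra.Bundles using (CommutativeRing)
open import Algebra.Structures using (IsCommutativeRing)
open import Algebra.Definitions.RawMonoid Q.+-0-rawMonoid using () renaming (_×_ to _×ℚ_)
open import Tactic.RingSolver using (solve-∀)
open import Tactic.RingSolver.Core.AlmostCommutativeRing using (AlmostCommutativeRing; fromCommutativeRing)
import Data.Integer.Tactic.RingSolver as ℤ-Solver

-- The field ℚ(i)

ℚ-ring : AlmostCommutativeRing 0ℓ 0ℓ
ℚ-ring = fromCommutativeRing Q.+-*-commutativeRing (λ x → dec⇒maybe (0ℚ Q.≟ x))

negᵢ : ℚi → ℚi
negᵢ (cplx a b) = cplx (Q.- a) (Q.- b)

_≟ᵢ_ : (z w : ℚi) → Dec (z ≡ w)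
cplx a b ≟ᵢ cplx c d with a Q.≟ c | b Q.≟ d
... | yes refl | yes refl = yes refl
... | no a≢c   | _        = no λ { refl → a≢c refl }
... | yes _    | no b≢d   = no λ { refl → b≢d refl }

ℚi-isCommutativeRing : IsCommutativeRing _≡_ _+ᵢ_ _*ᵢ_ negᵢ 0ᵢ 1ᵢ
ℚi-isCommutativeRing = record
  { isRing = record
    { +-isAbelianGroup = record
      { isGroup = record
        { isMonoid = record
          { isSemigroup = record
            { isMagma = record { isEquivalence = isEquivalence ; ∙-cong = cong₂ _+ᵢ_ }
            ; assoc = λ { (cplx a b) (cplx c d) (cplx e f) → cong₂ cplx (Q.+-assoc a c e) (Q.+-assoc b d f) } }
          ; identity = (λ { (cplx a b) → cong₂ cplx (Q.+-identityˡ a) (Q.+-identityˡ b) })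
                     , (λ { (cplx a b) → cong₂ cplx (Q.+-identityʳ a) (Q.+-identityʳ b) }) }
        ; inverse = (λ { (cplx a b) → cong₂ cplx (Q.+-inverseˡ a) (Q.+-inverseˡ b) })
                  , (λ { (cplx a b) → cong₂ cplx (Q.+-inverseʳ a) (Q.+-inverseʳ b) })
        ; ⁻¹-cong = cong negᵢ }
      ; comm = λ { (cplx a b) (cplx c d) → cong₂ cplx (Q.+-comm a c) (Q.+-comm b d) } }
    ; *-cong = cong₂ _*ᵢ_
    ; *-assoc = λ { (cplx a b) (cplx c d) (cplx e f) → cong₂ cplx (*-assoc-re a b c d e f) (*-assoc-im a b c d e f) }
    ; *-identity = (λ { (cplx a b) → cong₂ cplx (*-identityˡ-re a b) (*-identityˡ-im a b) })
                 , (λ { (cplx a b) → cong₂ cplx (*-identityʳ-re a b) (*-identityʳ-im a b) })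
    ; distrib = (λ { (cplx a b) (cplx c d) (cplx e f) → cong₂ cplx (distribˡ-re a b c d e f) (distribˡ-im a b c d e f) })
              , (λ { (cplx a b) (cplx c d) (cplx e f) → cong₂ cplx (distribʳ-re a b c d e f) (distribʳ-im a b c d e f) })
    }
  ; *-comm = λ { (cplx a b) (cplx c d) → cong₂ cplx (*-comm-re a b c d) (*-comm-im a b c d) }
  }
  where
  open import Data.Rational using (_+_; _*_; _-_)
  *-assoc-re : ∀ a b c d e f → (a * c - b * d) * e - (a * d + b * c) * f ≡ a * (c * e - d * f) - b * (c * f + d * e)
  *-assoc-re = solve-∀ ℚ-ring
  *-assoc-im : ∀ a b c d e f → (a * c - b * d) * f + (a * d + b * c) * e ≡ a * (c * f + d * e) + b * (c * e - d * f)
  *-assoc-im = solve-∀ ℚ-ring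
  *-identityˡ-re : ∀ a b → 1ℚ * a - 0ℚ * b ≡ a
  *-identityˡ-re = solve-∀ ℚ-ring
  *-identityˡ-im : ∀ a b → 1ℚ * b + 0ℚ * a ≡ b
  *-identityˡ-im = solve-∀ ℚ-ring
  *-identityʳ-re : ∀ a b → a * 1ℚ - b * 0ℚ ≡ a
  *-identityʳ-re = solve-∀ ℚ-ring
  *-identityʳ-im : ∀ a b → a * 0ℚ + b * 1ℚ ≡ b
  *-identityʳ-im = solve-∀ ℚ-ring
  distribˡ-re : ∀ a b c d e f → a * (c + e) - b * (d + f) ≡ (a * c - b * d) + (a * e - b * f)
  distribˡ-re = solve-∀ ℚ-ring
  distribˡ-im : ∀ a b c d e f → a * (d + f) + b * (c + e) ≡ (a * d + b * c) + (a * f + b * e)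
  distribˡ-im = solve-∀ ℚ-ring
  distribʳ-re : ∀ a b c d e f → (c + e) * a - (d + f) * b ≡ (c * a - d * b) + (e * a - f * b)
  distribʳ-re = solve-∀ ℚ-ring
  distribʳ-im : ∀ a b c d e f → (c + e) * b + (d + f) * a ≡ (c * b + d * a) + (e * b + f * a)
  distribʳ-im = solve-∀ ℚ-ring
  *-comm-re : ∀ a b c d → a * c - b * d ≡ c * a - d * b
  *-comm-re = solve-∀ ℚ-ring
  *-comm-im : ∀ a b c d → a * d + b * c ≡ c * b + d * a
  *-comm-im = solve-∀ ℚ-ring

ℚi-commutativeRing : CommutativeRing 0ℓ 0ℓ
ℚi-commutativeRing = record { isCommutativeRing = ℚi-isCommutativeRing }

ℚi-ring : AlmostCommutativeRing 0ℓ 0ℓ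
ℚi-ring = fromCommutativeRing ℚi-commutativeRing (λ z → dec⇒maybe (0ᵢ ≟ᵢ z))

-- The ring solver recognises these names, but not the projections of ℚi-commutativeRing.
infixl 6 _+_ _-_
infixl 7 _*_
infix 8 -_

_+_ _*_ _-_ : ℚi → ℚi → ℚi
_+_ = _+ᵢ_
_*_ = _*ᵢ_
x - y = x + negᵢ y

-_ : ℚi → ℚi
-_ = negᵢ

open CommutativeRing ℚi-commutativeRing
  using (+-assoc; +-identityˡ; +-identityʳ; *-assoc; *-identityˡ; distribˡ; distribʳ; zeroˡ; zeroʳ)
open import Algebra.Properties.Semiring.Mult (CommutativeRing.semiring ℚi-commutativeRing)
  using (×-homo-+; ×1-homo-*) renaming (_×_ to _×ᵢ_)
open import Algebra.Properties.Monoid.Sum (CommutativeRing.+-monoid ℚi-commutativeRing)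
  using (sum; sum-syntax; sum-cong-≗; sum-init-last; sum-replicate-zero)
open import Algebra.Properties.CommutativeMonoid.Sum (CommutativeRing.+-commutativeMonoid ℚi-commutativeRing)
  using (∑-distrib-+)
open import Algebra.Properties.Semiring.Sum (CommutativeRing.semiring ℚi-commutativeRing)
  using (*-distribˡ-sum)

ι : ℕ → ℚi
ι n = n ×ᵢ 1ᵢ

ι-+ : ∀ m n → ι (m ℕ.+ n) ≡ ι m + ι n
ι-+ = ×-homo-+ 1ᵢ

ι-* : ∀ m n → ι (m ℕ.* n) ≡ ι m * ι n
ι-* = ×1-homo-*

sumFin≡sum : ∀ m (f : Fin m → ℚi) → sumFin m f ≡ sum f
sumFin≡sum zero    f = refl
sumFin≡sum (suc m) f = cong (f zero +_) (sumFin≡sum m (f ∘ suc))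

sumFin-cong : ∀ m {f g : Fin m → ℚi} → f ≗ g → sumFin m f ≡ sumFin m g
sumFin-cong m {f} {g} f≗g = begin
  sumFin m f ≡⟨ sumFin≡sum m f ⟩
  sum f      ≡⟨ sum-cong-≗ f≗g ⟩
  sum g      ≡⟨ sumFin≡sum m g ⟨
  sumFin m g ∎

module _ {k : ℕ} where

  dot≡sum : (a b : Fin k → ℚi) → dot a b ≡ ∑[ j < k ] (a j * b j)
  dot≡sum a b = sumFin≡sum k _

  dot-cong : ∀ {a a′ b b′ : Fin k → ℚi} → a ≗ a′ → b ≗ b′ → dot a b ≡ dot a′ b′
  dot-cong a≗a′ b≗b′ = sumFin-cong k (λ j → cong₂ _*_ (a≗a′ j) (b≗b′ j))

  dot-congˡ : ∀ {a a′ : Fin k → ℚi} (b : Fin k → ℚi) → a ≗ a′ → dot a b ≡ dot a′ b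
  dot-congˡ b a≗a′ = dot-cong a≗a′ (λ j → refl {x = b j})

  dot-congʳ : ∀ (a : Fin k → ℚi) {b b′ : Fin k → ℚi} → b ≗ b′ → dot a b ≡ dot a b′
  dot-congʳ a b≗b′ = dot-cong (λ j → refl {x = a j}) b≗b′

  dot-distribˡ : (a a′ b : Fin k → ℚi) → dot (λ j → a j + a′ j) b ≡ dot a b + dot a′ b
  dot-distribˡ a a′ b = begin
    dot (λ j → a j + a′ j) b                          ≡⟨ dot≡sum (λ j → a j + a′ j) b ⟩
    ∑[ j < k ] ((a j + a′ j) * b j)                   ≡⟨ sum-cong-≗ (λ j → distribʳ (b j) (a j) (a′ j)) ⟩
    ∑[ j < k ] (a j * b j + a′ j * b j)               ≡⟨ ∑-distrib-+ (λ j → a j * b j) (λ j → a′ j * b j) ⟩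
    ∑[ j < k ] (a j * b j) + ∑[ j < k ] (a′ j * b j)  ≡⟨ cong₂ _+_ (dot≡sum a b) (dot≡sum a′ b) ⟨
    dot a b + dot a′ b                                ∎

  dot-distribʳ : (a b b′ : Fin k → ℚi) → dot a (λ j → b j + b′ j) ≡ dot a b + dot a b′
  dot-distribʳ a b b′ = begin
    dot a (λ j → b j + b′ j)                          ≡⟨ dot≡sum a (λ j → b j + b′ j) ⟩
    ∑[ j < k ] (a j * (b j + b′ j))                   ≡⟨ sum-cong-≗ (λ j → distribˡ (a j) (b j) (b′ j)) ⟩
    ∑[ j < k ] (a j * b j + a j * b′ j)               ≡⟨ ∑-distrib-+ (λ j → a j * b j) (λ j → a j * b′ j) ⟩
    ∑[ j < k ] (a j * b j) + ∑[ j < k ] (a j * b′ j)  ≡⟨ cong₂ _+_ (dot≡sum a b) (dot≡sum a b′) ⟨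
    dot a b + dot a b′                                ∎

  dot-scale : ∀ {a a′ b b′ : Fin k → ℚi} α β → (∀ j → a′ j ≡ α * a j) → (∀ j → b′ j ≡ β * b j) →
              dot a′ b′ ≡ α * β * dot a b
  dot-scale {a} {a′} {b} {b′} α β a′≡αa b′≡βb = begin
    dot a′ b′                         ≡⟨ dot≡sum a′ b′ ⟩
    ∑[ j < k ] (a′ j * b′ j)          ≡⟨ sum-cong-≗ (λ j → trans (cong₂ _*_ (a′≡αa j) (b′≡βb j)) (interchange α β (a j) (b j))) ⟩
    ∑[ j < k ] (α * β * (a j * b j))  ≡⟨ *-distribˡ-sum (α * β) (λ j → a j * b j) ⟨
    α * β * ∑[ j < k ] (a j * b j)    ≡⟨ cong (α * β *_) (dot≡sum a b) ⟨
    α * β * dot a b                   ∎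
    where
    interchange : ∀ p q x y → p * x * (q * y) ≡ p * q * (x * y)
    interchange = solve-∀ ℚi-ring

  dot-zeroˡ : ∀ {a : Fin k → ℚi} (b : Fin k → ℚi) → (∀ j → a j ≡ 0ᵢ) → dot a b ≡ 0ᵢ
  dot-zeroˡ {a} b a≡0 = begin
    dot a b                 ≡⟨ dot≡sum a b ⟩
    ∑[ j < k ] (a j * b j)  ≡⟨ sum-cong-≗ (λ j → trans (cong (_* b j) (a≡0 j)) (zeroˡ (b j))) ⟩
    ∑[ _ < k ] 0ᵢ           ≡⟨ sum-replicate-zero k ⟩
    0ᵢ                      ∎

  dot-zeroʳ : ∀ (a : Fin k → ℚi) {b : Fin k → ℚi} → (∀ j → b j ≡ 0ᵢ) → dot a b ≡ 0ᵢ
  dot-zeroʳ a {b} b≡0 = begin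
    dot a b                 ≡⟨ dot≡sum a b ⟩
    ∑[ j < k ] (a j * b j)  ≡⟨ sum-cong-≗ (λ j → trans (cong (a j *_) (b≡0 j)) (zeroʳ (a j))) ⟩
    ∑[ _ < k ] 0ᵢ           ≡⟨ sum-replicate-zero k ⟩
    0ᵢ                      ∎

-- The Heisenberg group

record Heis (k : ℕ) : Set where
  constructor heis
  field
    m₁ m₂ : Fin k → ℚi
    m₃    : ℚi
open Heis public

module _ {k : ℕ} where

  β : Heis k → Heis k → ℚi
  β s t = dot (m₁ s) (m₂ t)

  infixl 7 _·_
  _·_ : Heis k → Heis k → Heis k
  s · t = heis (λ j → m₁ s j + m₁ t j) (λ j → m₂ s j + m₂ t j) (m₃ s + m₃ t + β s t)

  ε : Heis k
  ε = heis (λ _ → 0ᵢ) (λ _ → 0ᵢ) 0ᵢ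

  infixr 8 _^_
  _^_ : Heis k → ℕ → Heis k
  x ^ zero  = ε
  x ^ suc n = x · x ^ n

  β-·ˡ : ∀ s t u → β (s · t) u ≡ β s u + β t u
  β-·ˡ s t u = dot-distribˡ (m₁ s) (m₁ t) (m₂ u)

  β-·ʳ : ∀ s t u → β s (t · u) ≡ β s t + β s u
  β-·ʳ s t u = dot-distribʳ (m₁ s) (m₂ t) (m₂ u)

  vec : Heis k → Fin k ⊎ Fin k → ℚi
  vec s (inj₁ j) = m₁ s j
  vec s (inj₂ j) = m₂ s j

  vec-· : ∀ s t κ → vec (s · t) κ ≡ vec s κ + vec t κ
  vec-· s t (inj₁ j) = refl
  vec-· s t (inj₂ j) = refl

  vec-ε : ∀ κ → vec ε κ ≡ 0ᵢ
  vec-ε (inj₁ j) = refl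
  vec-ε (inj₂ j) = refl

  infix 4 _≈_
  _≈_ : Heis k → Heis k → Set
  s ≈ t = vec s ≗ vec t × m₃ s ≡ m₃ t

  ≈-refl : ∀ {s} → s ≈ s
  ≈-refl = (λ _ → refl) , refl

  ≈-sym : ∀ {s t} → s ≈ t → t ≈ s
  ≈-sym (v , c) = (λ κ → sym (v κ)) , sym c

  ≈-trans : ∀ {s t u} → s ≈ t → t ≈ u → s ≈ u
  ≈-trans (v , c) (v′ , c′) = (λ κ → trans (v κ) (v′ κ)) , trans c c′

  ·-cong : ∀ {s s′ t t′} → s ≈ s′ → t ≈ t′ → s · t ≈ s′ · t′
  ·-cong {s} {s′} {t} {t′} (v , c) (v′ , c′) =
    (λ κ → trans (vec-· s t κ) (trans (cong₂ _+_ (v κ) (v′ κ)) (sym (vec-· s′ t′ κ)))) ,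
    cong₂ _+_ (cong₂ _+_ c c′) (dot-cong (v ∘ inj₁) (v′ ∘ inj₂))

  ·-assoc : ∀ s t u → (s · t) · u ≈ s · (t · u)
  ·-assoc s t u = (λ κ → vec-assoc κ) , (begin
      m₃ s + m₃ t + β s t + m₃ u + β (s · t) u
        ≡⟨ cong (m₃ s + m₃ t + β s t + m₃ u +_) (β-·ˡ s t u) ⟩
      m₃ s + m₃ t + β s t + m₃ u + (β s u + β t u)
        ≡⟨ rearrange (m₃ s) (m₃ t) (m₃ u) (β s t) (β s u) (β t u) ⟩
      m₃ s + (m₃ t + m₃ u + β t u) + (β s t + β s u)
        ≡⟨ cong (m₃ s + (m₃ t + m₃ u + β t u) +_) (β-·ʳ s t u) ⟨
      m₃ s + (m₃ t + m₃ u + β t u) + β s (t · u)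
        ∎)
    where
    vec-assoc : ∀ κ → vec ((s · t) · u) κ ≡ vec (s · (t · u)) κ
    vec-assoc (inj₁ j) = +-assoc (m₁ s j) (m₁ t j) (m₁ u j)
    vec-assoc (inj₂ j) = +-assoc (m₂ s j) (m₂ t j) (m₂ u j)
    rearrange : ∀ cs ct cu bst bsu btu → cs + ct + bst + cu + (bsu + btu) ≡ cs + (ct + cu + btu) + (bst + bsu)
    rearrange = solve-∀ ℚi-ring

  ·-identityˡ : ∀ s → ε · s ≈ s
  ·-identityˡ s = (λ κ → trans (vec-· ε s κ) (trans (cong (_+ vec s κ) (vec-ε κ)) (+-identityˡ (vec s κ)))) ,
    trans (cong (0ᵢ + m₃ s +_) (dot-zeroˡ (m₂ s) (λ _ → refl))) (unit (m₃ s))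
    where
    unit : ∀ a → 0ᵢ + a + 0ᵢ ≡ a
    unit = solve-∀ ℚi-ring

  ·-identityʳ : ∀ s → s · ε ≈ s
  ·-identityʳ s = (λ κ → trans (vec-· s ε κ) (trans (cong (vec s κ +_) (vec-ε κ)) (+-identityʳ (vec s κ)))) ,
    trans (cong (m₃ s + 0ᵢ +_) (dot-zeroʳ (m₁ s) (λ _ → refl))) (unit (m₃ s))
    where
    unit : ∀ a → a + 0ᵢ + 0ᵢ ≡ a
    unit = solve-∀ ℚi-ring

  IsΩ : Heis k → Set
  IsΩ s = ∀ κ → vec s κ ≡ 0ᵢ

  Ω-· : ∀ {s t} → IsΩ s → IsΩ t → IsΩ (s · t)
  Ω-· {s} {t} s∈Ω t∈Ω κ = trans (vec-· s t κ) (trans (cong₂ _+_ (s∈Ω κ) (t∈Ω κ)) (+-identityʳ 0ᵢ))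

  m₃-Ω-· : ∀ {s} t → IsΩ s → m₃ (s · t) ≡ m₃ s + m₃ t
  m₃-Ω-· {s} t s∈Ω = trans (cong (m₃ s + m₃ t +_) (dot-zeroˡ (m₂ t) (s∈Ω ∘ inj₁))) (+-identityʳ (m₃ s + m₃ t))

  Ω-≈ε : ∀ {s} → IsΩ s → m₃ s ≡ 0ᵢ → s ≈ ε
  Ω-≈ε s∈Ω m₃≡0 = (λ κ → trans (s∈Ω κ) (sym (vec-ε κ))) , m₃≡0

  infix 4 _∼[_]_
  record _∼[_]_ (s : Heis k) (α : ℚi) (t : Heis k) : Set where
    constructor scaled
    field
      vec-scaled : ∀ κ → vec s κ ≡ α * vec t κ
  open _∼[_]_ public

  ∼-refl : ∀ {s} → s ∼[ 1ᵢ ] s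
  ∼-refl {s} = scaled λ κ → sym (*-identityˡ (vec s κ))

  ∼-trans : ∀ {s t u α γ} → s ∼[ α ] t → t ∼[ γ ] u → s ∼[ α * γ ] u
  ∼-trans {s} {t} {u} {α} {γ} (scaled s∼t) (scaled t∼u) =
    scaled λ κ → trans (s∼t κ) (trans (cong (α *_) (t∼u κ)) (sym (*-assoc α γ (vec u κ))))

  ^-∼ : ∀ x n → x ^ n ∼[ ι n ] x
  ^-∼ x zero    = scaled λ κ → trans (vec-ε κ) (sym (zeroˡ (vec x κ)))
  ^-∼ x (suc n) = scaled λ κ →
    trans (vec-· x (x ^ n) κ) (trans (cong (vec x κ +_) (vec-scaled (^-∼ x n) κ)) (collect (ι n) (vec x κ)))
    where
    collect : ∀ ν a → a + ν * a ≡ (1ᵢ + ν) * a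
    collect = solve-∀ ℚi-ring

  β-scale : ∀ {s s′ t t′ α γ} → s ∼[ α ] s′ → t ∼[ γ ] t′ → β s t ≡ α * γ * β s′ t′
  β-scale {α = α} {γ} (scaled s∼s′) (scaled t∼t′) = dot-scale α γ (s∼s′ ∘ inj₁) (t∼t′ ∘ inj₂)

  inverse-mod-Ω : ∀ {x X} → IsΩ (x · X) → X ∼[ - 1ᵢ ] x
  inverse-mod-Ω {x} {X} xX∈Ω = scaled λ κ → begin
    vec X κ                               ≡⟨ isolate (vec x κ) (vec X κ) ⟩
    (vec x κ + vec X κ) + - 1ᵢ * vec x κ  ≡⟨ cong (_+ - 1ᵢ * vec x κ) (trans (sym (vec-· x X κ)) (xX∈Ω κ)) ⟩
    0ᵢ + - 1ᵢ * vec x κ                   ≡⟨ +-identityˡ (- 1ᵢ * vec x κ) ⟩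
    - 1ᵢ * vec x κ                        ∎
    where
    isolate : ∀ a b → b ≡ (a + b) + - 1ᵢ * a
    isolate = solve-∀ ℚi-ring

  m₃-inverse : ∀ {x X} → X ∼[ - 1ᵢ ] x → m₃ x + m₃ X ≡ m₃ (x · X) + β x x
  m₃-inverse {x} {X} X∼x = begin
    m₃ x + m₃ X                                      ≡⟨ cancel (m₃ x + m₃ X) (β x x) ⟩
    m₃ x + m₃ X + 1ᵢ * - 1ᵢ * β x x + β x x          ≡⟨ cong (λ b → m₃ x + m₃ X + b + β x x) (β-scale (∼-refl {x}) X∼x) ⟨
    m₃ (x · X) + β x x                               ∎
    where
    cancel : ∀ c b → c ≡ c + 1ᵢ * - 1ᵢ * b + b
    cancel = solve-∀ ℚi-ring

  m₃-^-inverse : ∀ {x X} → X ∼[ - 1ᵢ ] x → ∀ n →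
                 m₃ (x ^ n) + m₃ (X ^ n) ≡ ι n * m₃ (x · X) + ι n * ι n * β x x
  m₃-^-inverse {x} {X} X∼x zero = base (m₃ (x · X)) (β x x)
    where
    base : ∀ c b → 0ᵢ + 0ᵢ ≡ 0ᵢ * c + 0ᵢ * 0ᵢ * b
    base = solve-∀ ℚi-ring
  m₃-^-inverse {x} {X} X∼x (suc n) = begin
    m₃ x + m₃ (x ^ n) + β x (x ^ n) + (m₃ X + m₃ (X ^ n) + β X (X ^ n))
      ≡⟨ cong₂ (λ p q → m₃ x + m₃ (x ^ n) + p + (m₃ X + m₃ (X ^ n) + q))
               (β-scale (∼-refl {x}) (^-∼ x n)) (β-scale X∼x (∼-trans (^-∼ X n) X∼x)) ⟩
    m₃ x + m₃ (x ^ n) + 1ᵢ * ν * b + (m₃ X + m₃ (X ^ n) + - 1ᵢ * (ν * - 1ᵢ) * b)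
      ≡⟨ regroup (m₃ x) (m₃ X) (m₃ (x ^ n)) (m₃ (X ^ n)) ν b ⟩
    (m₃ (x ^ n) + m₃ (X ^ n)) + (m₃ x + m₃ X) + (ν + ν) * b
      ≡⟨ cong₂ (λ p q → p + q + (ν + ν) * b) (m₃-^-inverse X∼x n) (m₃-inverse X∼x) ⟩
    ν * m₃ (x · X) + ν * ν * b + (m₃ (x · X) + b) + (ν + ν) * b
      ≡⟨ collect ν (m₃ (x · X)) b ⟩
    (1ᵢ + ν) * m₃ (x · X) + (1ᵢ + ν) * (1ᵢ + ν) * b
      ∎
    where
    ν b : ℚi
    ν = ι n
    b = β x x
    regroup : ∀ cx cX p q ν b →
      cx + p + 1ᵢ * ν * b + (cX + q + - 1ᵢ * (ν * - 1ᵢ) * b) ≡ (p + q) + (cx + cX) + (ν + ν) * b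
    regroup = solve-∀ ℚi-ring
    collect : ∀ ν c b → ν * c + ν * ν * b + (c + b) + (ν + ν) * b ≡ (1ᵢ + ν) * c + (1ᵢ + ν) * (1ᵢ + ν) * b
    collect = solve-∀ ℚi-ring

  m₃-·₄ : ∀ p q r s → m₃ (p · (q · (r · s))) ≡
          (m₃ p + m₃ r) + (m₃ q + m₃ s) + (β p q + β p r + β p s + β q r + β q s + β r s)
  m₃-·₄ p q r s = begin
    m₃ p + (m₃ q + (m₃ r + m₃ s + β r s) + β q (r · s)) + β p (q · (r · s))
      ≡⟨ cong₂ (λ a b → m₃ p + (m₃ q + (m₃ r + m₃ s + β r s) + a) + b)
               (β-·ʳ q r s) (trans (β-·ʳ p q (r · s)) (cong (β p q +_) (β-·ʳ p r s))) ⟩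
    m₃ p + (m₃ q + (m₃ r + m₃ s + β r s) + (β q r + β q s)) + (β p q + (β p r + β p s))
      ≡⟨ regroup (m₃ p) (m₃ q) (m₃ r) (m₃ s) (β p q) (β p r) (β p s) (β q r) (β q s) (β r s) ⟩
    (m₃ p + m₃ r) + (m₃ q + m₃ s) + (β p q + β p r + β p s + β q r + β q s + β r s)
      ∎
    where
    regroup : ∀ cp cq cr cs bpq bpr bps bqr bqs brs →
      cp + (cq + (cr + cs + brs) + (bqr + bqs)) + (bpq + (bpr + bps)) ≡
      (cp + cr) + (cq + cs) + (bpq + bpr + bps + bqr + bqs + brs)
    regroup = solve-∀ ℚi-ring

  block : Heis k → Heis k → Heis k → Heis k → ℕ → Heis k
  block x y X Y n = x ^ n · (y ^ n · (X ^ n · Y ^ n))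

  module _ {x y X Y : Heis k} (X∼x : X ∼[ - 1ᵢ ] x) (Y∼y : Y ∼[ - 1ᵢ ] y) (n : ℕ) where

    private
      ν : ℚi
      ν = ι n
      P∼x : x ^ n ∼[ ν ] x
      P∼x = ^-∼ x n
      Q∼y : y ^ n ∼[ ν ] y
      Q∼y = ^-∼ y n
      R∼x : X ^ n ∼[ ν * - 1ᵢ ] x
      R∼x = ∼-trans (^-∼ X n) X∼x
      S∼y : Y ^ n ∼[ ν * - 1ᵢ ] y
      S∼y = ∼-trans (^-∼ Y n) Y∼y

    block-Ω : IsΩ (block x y X Y n)
    block-Ω κ = begin
      vec (block x y X Y n) κ
        ≡⟨ trans (vec-· (x ^ n) _ κ) (cong (vec (x ^ n) κ +_)
             (trans (vec-· (y ^ n) _ κ) (cong (vec (y ^ n) κ +_) (vec-· (X ^ n) (Y ^ n) κ)))) ⟩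
      vec (x ^ n) κ + (vec (y ^ n) κ + (vec (X ^ n) κ + vec (Y ^ n) κ))
        ≡⟨ cong₂ _+_ (vec-scaled P∼x κ)
             (cong₂ _+_ (vec-scaled Q∼y κ) (cong₂ _+_ (vec-scaled R∼x κ) (vec-scaled S∼y κ))) ⟩
      ν * vec x κ + (ν * vec y κ + (ν * - 1ᵢ * vec x κ + ν * - 1ᵢ * vec y κ))
        ≡⟨ cancel ν (vec x κ) (vec y κ) ⟩
      0ᵢ ∎
      where
      cancel : ∀ ν a b → ν * a + (ν * b + (ν * - 1ᵢ * a + ν * - 1ᵢ * b)) ≡ 0ᵢ
      cancel = solve-∀ ℚi-ring

    block-m₃ : m₃ (block x y X Y n) ≡ ν * (m₃ (x · X) + m₃ (y · Y)) + ν * ν * (β x y - β y x)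
    block-m₃ = begin
      m₃ (block x y X Y n)
        ≡⟨ m₃-·₄ P Q R S ⟩
      (m₃ P + m₃ R) + (m₃ Q + m₃ S) + (β P Q + β P R + β P S + β Q R + β Q S + β R S)
        ≡⟨ cong₂ _+_ (cong₂ _+_ (m₃-^-inverse X∼x n) (m₃-^-inverse Y∼y n)) cross-terms ⟩
      (ν * Ux + ν * ν * β x x) + (ν * Uy + ν * ν * β y y) +
        (ν * ν * β x y + ν * (ν * - 1ᵢ) * β x x + ν * (ν * - 1ᵢ) * β x y + ν * (ν * - 1ᵢ) * β y x
         + ν * (ν * - 1ᵢ) * β y y + ν * - 1ᵢ * (ν * - 1ᵢ) * β x y)
        ≡⟨ collect ν Ux Uy (β x x) (β x y) (β y x) (β y y) ⟩
      ν * (Ux + Uy) + ν * ν * (β x y - β y x) ∎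
      where
      P Q R S : Heis k
      P = x ^ n
      Q = y ^ n
      R = X ^ n
      S = Y ^ n
      Ux Uy : ℚi
      Ux = m₃ (x · X)
      Uy = m₃ (y · Y)
      cross-terms : β P Q + β P R + β P S + β Q R + β Q S + β R S ≡
        ν * ν * β x y + ν * (ν * - 1ᵢ) * β x x + ν * (ν * - 1ᵢ) * β x y + ν * (ν * - 1ᵢ) * β y x
        + ν * (ν * - 1ᵢ) * β y y + ν * - 1ᵢ * (ν * - 1ᵢ) * β x y
      cross-terms = cong₂ _+_ (cong₂ _+_ (cong₂ _+_ (cong₂ _+_ (cong₂ _+_
        (β-scale P∼x Q∼y) (β-scale P∼x R∼x)) (β-scale P∼x S∼y)) (β-scale Q∼y R∼x)) (β-scale Q∼y S∼y)) (β-scale R∼x S∼y)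
      collect : ∀ ν ux uy bxx bxy byx byy →
        (ν * ux + ν * ν * bxx) + (ν * uy + ν * ν * byy) +
          (ν * ν * bxy + ν * (ν * - 1ᵢ) * bxx + ν * (ν * - 1ᵢ) * bxy + ν * (ν * - 1ᵢ) * byx
           + ν * (ν * - 1ᵢ) * byy + ν * - 1ᵢ * (ν * - 1ᵢ) * bxy)
        ≡ ν * (ux + uy) + ν * ν * (bxy - byx)
      collect = solve-∀ ℚi-ring

-- Heisenberg matrices

≈M-trans : ∀ {n} {A B C : Mat n} → A ≈M B → B ≈M C → A ≈M C
≈M-trans A≈B B≈C i j = trans (A≈B i j) (B≈C i j)

*M-cong : ∀ {n} {A A′ B B′ : Mat n} → A ≈M A′ → B ≈M B′ → (A *M B) ≈M (A′ *M B′)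
*M-cong {n} A≈A′ B≈B′ i j = sumFin-cong n (λ l → cong₂ _*_ (A≈A′ i l) (B≈B′ l j))

Iₙ-diag : ∀ {n} (i : Fin n) → Iₙ i i ≡ 1ᵢ
Iₙ-diag i with i ≟ i
... | yes _   = refl
... | no i≢i = ⊥-elim (i≢i refl)

Iₙ-off : ∀ {n} {i j : Fin n} → i ≢ j → Iₙ i j ≡ 0ᵢ
Iₙ-off {i = i} {j} i≢j with i ≟ j
... | yes i≡j = ⊥-elim (i≢j i≡j)
... | no _    = refl

Iₙ-injective : ∀ {m n} (g : Fin m → Fin n) → (∀ {i j} → g i ≡ g j → i ≡ j) → ∀ i j → Iₙ (g i) (g j) ≡ Iₙ i j
Iₙ-injective g g-injective i j with i ≟ j
... | yes refl = Iₙ-diag (g i)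
... | no i≢j   = Iₙ-off (i≢j ∘ g-injective)

dot-Iₙˡ : ∀ {k} (i : Fin k) (f : Fin k → ℚi) → dot (Iₙ i) f ≡ f i
dot-Iₙˡ zero f = trans (cong (1ᵢ * f zero +_) (dot-zeroˡ (f ∘ suc) (λ _ → refl))) (unit (f zero))
  where
  unit : ∀ a → 1ᵢ * a + 0ᵢ ≡ a
  unit = solve-∀ ℚi-ring
dot-Iₙˡ (suc i) f = begin
  0ᵢ * f zero + dot (λ l → Iₙ (suc i) (suc l)) (f ∘ suc)
    ≡⟨ cong (0ᵢ * f zero +_) (dot-congˡ (f ∘ suc) (Iₙ-injective suc suc-injective i)) ⟩
  0ᵢ * f zero + dot (Iₙ i) (f ∘ suc)
    ≡⟨ cong (0ᵢ * f zero +_) (dot-Iₙˡ i (f ∘ suc)) ⟩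
  0ᵢ * f zero + f (suc i)
    ≡⟨ absorb (f zero) (f (suc i)) ⟩
  f (suc i)
    ∎
  where
  absorb : ∀ a b → 0ᵢ * a + b ≡ b
  absorb = solve-∀ ℚi-ring

dot-Iₙʳ : ∀ {k} (f : Fin k → ℚi) (j : Fin k) → dot f (λ l → Iₙ l j) ≡ f j
dot-Iₙʳ f zero = trans (cong (f zero * 1ᵢ +_) (dot-zeroʳ (f ∘ suc) (λ _ → refl))) (unit (f zero))
  where
  unit : ∀ a → a * 1ᵢ + 0ᵢ ≡ a
  unit = solve-∀ ℚi-ring
dot-Iₙʳ f (suc j) = begin
  f zero * 0ᵢ + dot (f ∘ suc) (λ l → Iₙ (suc l) (suc j))
    ≡⟨ cong (f zero * 0ᵢ +_) (dot-congʳ (f ∘ suc) (λ l → Iₙ-injective suc suc-injective l j)) ⟩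
  f zero * 0ᵢ + dot (f ∘ suc) (λ l → Iₙ l j)
    ≡⟨ cong (f zero * 0ᵢ +_) (dot-Iₙʳ (f ∘ suc) j) ⟩
  f zero * 0ᵢ + f (suc j)
    ≡⟨ absorb (f zero) (f (suc j)) ⟩
  f (suc j)
    ∎
  where
  absorb : ∀ a b → a * 0ᵢ + b ≡ b
  absorb = solve-∀ ℚi-ring

mid-injective : ∀ {k} {i j : Fin k} → mid i ≡ mid j → i ≡ j
mid-injective = inject₁-injective ∘ suc-injective

mid≢lastI : ∀ {k} (j : Fin k) → mid j ≢ lastI k
mid≢lastI j = fromℕ≢inject₁ ∘ sym ∘ suc-injective

data Pos (k : ℕ) : Fin (suc (suc k)) → Set where
  first  : Pos k zero
  middle : (j : Fin k) → Pos k (mid j)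
  last   : Pos k (lastI k)

pos-shift : ∀ {k i} → Pos k (suc i) → Pos (suc k) (suc (suc i))
pos-shift (middle j) = middle (suc j)
pos-shift last       = last

pos-suc : ∀ k (i : Fin (suc k)) → Pos k (suc i)
pos-suc zero    zero    = last
pos-suc (suc k) zero    = middle zero
pos-suc (suc k) (suc i) = pos-shift (pos-suc k i)

pos : ∀ {k} (i : Fin (suc (suc k))) → Pos k i
pos zero    = first
pos (suc i) = pos-suc _ i

pos-middle : ∀ {k} (j : Fin k) → pos (mid j) ≡ middle j
pos-middle {suc k} zero    = refl
pos-middle {suc k} (suc j) = cong pos-shift (pos-middle j)

pos-last : ∀ k → pos (lastI k) ≡ last
pos-last zero    = refl
pos-last (suc k) = cong pos-shift (pos-last k)

pos-unique : ∀ {k i} (p : Pos k i) → pos i ≡ p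
pos-unique first      = refl
pos-unique (middle j) = pos-middle j
pos-unique {k} last   = pos-last k

module _ {k : ℕ} where

  entry : ∀ {i j} → Heis k → Pos k i → Pos k j → ℚi
  entry s first      first      = 1ᵢ
  entry s first      (middle j) = m₁ s j
  entry s first      last       = m₃ s
  entry s (middle i) first      = 0ᵢ
  entry s (middle i) (middle j) = Iₙ i j
  entry s (middle i) last       = m₂ s i
  entry s last       first      = 0ᵢ
  entry s last       (middle j) = 0ᵢ
  entry s last       last       = 1ᵢ

  toMat : Heis k → Mat (suc (suc k))
  toMat s i j = entry s (pos i) (pos j)

  cong-middle : ∀ a b {d d′ : ℚi} → d ≡ d′ → a + (d + b) ≡ a + (d′ + b)
  cong-middle a b = cong (λ d → a + (d + b))

  toMat-entry : ∀ s {i j} (p : Pos k i) (q : Pos k j) → toMat s i j ≡ entry s p q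
  toMat-entry s p q = cong₂ (entry s) (pos-unique p) (pos-unique q)

  sumFin-split : (f : Fin (suc (suc k)) → ℚi) → sumFin (suc (suc k)) f ≡ f zero + (sumFin k (f ∘ mid) + f (lastI k))
  sumFin-split f = begin
    sumFin (suc (suc k)) f                    ≡⟨ sumFin≡sum (suc (suc k)) f ⟩
    f zero + sum (f ∘ suc)                    ≡⟨ cong (f zero +_) (sum-init-last (f ∘ suc)) ⟩
    f zero + (sum (f ∘ mid) + f (lastI k))    ≡⟨ cong (λ m → f zero + (m + f (lastI k))) (sumFin≡sum k (f ∘ mid)) ⟨
    f zero + (sumFin k (f ∘ mid) + f (lastI k)) ∎

  product-entry : ∀ {i j} → Heis k → Heis k → Pos k i → Pos k j → ℚi
  product-entry s t p q =
    entry s p first * entry t first q + (dot (λ l → entry s p (middle l)) (λ l → entry t (middle l) q) + entry s p last * entry t last q)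

  *M-entry : ∀ s t {i j} (p : Pos k i) (q : Pos k j) → (toMat s *M toMat t) i j ≡ product-entry s t p q
  *M-entry s t {i} {j} p q = begin
    (toMat s *M toMat t) i j
      ≡⟨ sumFin-split (λ l → toMat s i l * toMat t l j) ⟩
    toMat s i zero * toMat t zero j
      + (dot (λ l → toMat s i (mid l)) (λ l → toMat t (mid l) j) + toMat s i (lastI k) * toMat t (lastI k) j)
      ≡⟨ cong₂ _+_ (cong₂ _*_ (toMat-entry s p first) (toMat-entry t first q))
                   (cong₂ _+_ (dot-cong (λ l → toMat-entry s p (middle l)) (λ l → toMat-entry t (middle l) q))
                              (cong₂ _*_ (toMat-entry s p last) (toMat-entry t last q))) ⟩
    product-entry s t p q
      ∎

  entry-· : ∀ s t {i j} (p : Pos k i) (q : Pos k j) → product-entry s t p q ≡ entry (s · t) p q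
  entry-· s t first      first =
    trans (cong-middle (1ᵢ * 1ᵢ) (m₃ s * 0ᵢ) (dot-zeroʳ {k} (m₁ s) λ _ → refl)) (first-first (m₃ s))
    where
    first-first : ∀ c → 1ᵢ * 1ᵢ + (0ᵢ + c * 0ᵢ) ≡ 1ᵢ
    first-first = solve-∀ ℚi-ring
  entry-· s t first      (middle j) =
    trans (cong-middle (1ᵢ * m₁ t j) (m₃ s * 0ᵢ) (dot-Iₙʳ (m₁ s) j)) (first-middle (m₁ s j) (m₁ t j) (m₃ s))
    where
    first-middle : ∀ a a′ c → 1ᵢ * a′ + (a + c * 0ᵢ) ≡ a + a′
    first-middle = solve-∀ ℚi-ring
  entry-· s t first      last =
    first-last (m₃ s) (m₃ t) (dot (m₁ s) (m₂ t))
    where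
    first-last : ∀ c c′ d → 1ᵢ * c′ + (d + c * 1ᵢ) ≡ c + c′ + d
    first-last = solve-∀ ℚi-ring
  entry-· s t (middle i) first =
    trans (cong-middle (0ᵢ * 1ᵢ) (m₂ s i * 0ᵢ) (dot-zeroʳ {k} (Iₙ i) λ _ → refl)) (middle-first (m₂ s i))
    where
    middle-first : ∀ b → 0ᵢ * 1ᵢ + (0ᵢ + b * 0ᵢ) ≡ 0ᵢ
    middle-first = solve-∀ ℚi-ring
  entry-· s t (middle i) (middle j) =
    trans (cong-middle (0ᵢ * m₁ t j) (m₂ s i * 0ᵢ) (dot-Iₙˡ i (λ l → Iₙ l j))) (middle-middle (m₁ t j) (m₂ s i) (Iₙ i j))
    where
    middle-middle : ∀ a b δ → 0ᵢ * a + (δ + b * 0ᵢ) ≡ δ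
    middle-middle = solve-∀ ℚi-ring
  entry-· s t (middle i) last =
    trans (cong-middle (0ᵢ * m₃ t) (m₂ s i * 1ᵢ) (dot-Iₙˡ i (m₂ t))) (middle-last (m₃ t) (m₂ s i) (m₂ t i))
    where
    middle-last : ∀ c b b′ → 0ᵢ * c + (b′ + b * 1ᵢ) ≡ b + b′
    middle-last = solve-∀ ℚi-ring
  entry-· s t last       first =
    trans (cong-middle (0ᵢ * 1ᵢ) (1ᵢ * 0ᵢ) (dot-zeroˡ {k} (λ _ → 0ᵢ) λ _ → refl)) last-first
    where
    last-first : 0ᵢ * 1ᵢ + (0ᵢ + 1ᵢ * 0ᵢ) ≡ 0ᵢ
    last-first = solve-∀ ℚi-ring
  entry-· s t last       (middle j) =
    trans (cong-middle (0ᵢ * m₁ t j) (1ᵢ * 0ᵢ) (dot-zeroˡ {k} (λ l → Iₙ l j) λ _ → refl)) (last-middle (m₁ t j))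
    where
    last-middle : ∀ a → 0ᵢ * a + (0ᵢ + 1ᵢ * 0ᵢ) ≡ 0ᵢ
    last-middle = solve-∀ ℚi-ring
  entry-· s t last       last =
    trans (cong-middle (0ᵢ * m₃ t) (1ᵢ * 1ᵢ) (dot-zeroˡ {k} (m₂ t) λ _ → refl)) (last-last (m₃ t))
    where
    last-last : ∀ c → 0ᵢ * c + (0ᵢ + 1ᵢ * 1ᵢ) ≡ 1ᵢ
    last-last = solve-∀ ℚi-ring

  toMat-· : ∀ s t → (toMat s *M toMat t) ≈M toMat (s · t)
  toMat-· s t i j = trans (*M-entry s t (pos i) (pos j)) (entry-· s t (pos i) (pos j))

  entry-ε : ∀ {i j} (p : Pos k i) (q : Pos k j) → entry ε p q ≡ Iₙ i j
  entry-ε first      first      = refl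
  entry-ε first      (middle j) = refl
  entry-ε first      last       = refl
  entry-ε (middle i) first      = refl
  entry-ε (middle i) (middle j) = sym (Iₙ-injective mid mid-injective i j)
  entry-ε (middle i) last       = sym (Iₙ-off (mid≢lastI i))
  entry-ε last       first      = refl
  entry-ε last       (middle j) = sym (Iₙ-off (mid≢lastI j ∘ sym))
  entry-ε last       last       = sym (Iₙ-diag (lastI k))

  toMat-ε : toMat ε ≈M Iₙ
  toMat-ε i j = entry-ε (pos i) (pos j)

  entry-cong : ∀ {s t i j} → s ≈ t → (p : Pos k i) (q : Pos k j) → entry s p q ≡ entry t p q
  entry-cong s≈t         first      first      = refl
  entry-cong (v , _)     first      (middle j) = v (inj₁ j)
  entry-cong (_ , m₃≡)   first      last       = m₃≡
  entry-cong s≈t         (middle i) first      = refl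
  entry-cong s≈t         (middle i) (middle j) = refl
  entry-cong (v , _)     (middle i) last       = v (inj₂ i)
  entry-cong s≈t         last       first      = refl
  entry-cong s≈t         last       (middle j) = refl
  entry-cong s≈t         last       last       = refl

  toMat-cong : ∀ {s t} → s ≈ t → toMat s ≈M toMat t
  toMat-cong s≈t i j = entry-cong s≈t (pos i) (pos j)

  ψ : Mat (suc (suc k)) → Heis k
  ψ M = heis (ψ₁ M) (ψ₂ M) (ψ₃ M)

  entry-ψ : ∀ {M} → IsH k M → ∀ {i j} (p : Pos k i) (q : Pos k j) → M i j ≡ entry (ψ M) p q
  entry-ψ M∈H first      (middle j) = refl
  entry-ψ M∈H first      last       = refl
  entry-ψ M∈H (middle i) last       = refl
  entry-ψ M∈H first      first      =
    trans (M∈H _ _ λ { (inj₁ (_ , j≢0)) → j≢0 refl ; (inj₂ (() , _)) }) (sym (entry-ε first first))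
  entry-ψ M∈H (middle i) first      =
    trans (M∈H _ _ λ { (inj₁ (() , _)) ; (inj₂ (() , _)) }) (sym (entry-ε (middle i) first))
  entry-ψ M∈H (middle i) (middle j) =
    trans (M∈H _ _ λ { (inj₁ (() , _)) ; (inj₂ (e , _)) → mid≢lastI j e }) (sym (entry-ε (middle i) (middle j)))
  entry-ψ M∈H last       first      =
    trans (M∈H _ _ λ { (inj₁ (() , _)) ; (inj₂ (() , _)) }) (sym (entry-ε last first))
  entry-ψ M∈H last       (middle j) =
    trans (M∈H _ _ λ { (inj₁ (() , _)) ; (inj₂ (e , _)) → mid≢lastI j e }) (sym (entry-ε last (middle j)))
  entry-ψ M∈H last       last       =
    trans (M∈H _ _ λ { (inj₁ (() , _)) ; (inj₂ (_ , i≢last)) → i≢last refl }) (sym (entry-ε last last))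

  toMat-ψ : ∀ {M} → IsH k M → M ≈M toMat (ψ M)
  toMat-ψ M∈H i j = entry-ψ M∈H (pos i) (pos j)

  InΩ⇒IsΩ : ∀ {M s} → M ≈M toMat s → InΩ k M → IsΩ s
  InΩ⇒IsΩ {s = s} M≈s (_ , ψ₁≡0 , ψ₂≡0) (inj₁ j) =
    trans (sym (trans (M≈s zero (mid j)) (toMat-entry s first (middle j)))) (ψ₁≡0 j)
  InΩ⇒IsΩ {s = s} M≈s (_ , ψ₁≡0 , ψ₂≡0) (inj₂ j) =
    trans (sym (trans (M≈s (mid j) (lastI k)) (toMat-entry s (middle j) last))) (ψ₂≡0 j)

-- Clearing denominators

ιℚ : ℕ → ℚ
ιℚ n = n ×ℚ 1ℚ

ρ : ℚ → ℚi
ρ q = cplx q 0ℚ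

ρ-ιℚ : ∀ n → ρ (ιℚ n) ≡ ι n
ρ-ιℚ zero    = refl
ρ-ιℚ (suc n) = cong (1ᵢ +_) (ρ-ιℚ n)

ρ-* : ∀ a b → ρ a * ρ b ≡ ρ (a Q.* b)
ρ-* a b = cong₂ cplx (re-part a b) (im-part a b)
  where
  re-part : ∀ a b → a Q.* b Q.- 0ℚ Q.* 0ℚ ≡ a Q.* b
  re-part = solve-∀ ℚ-ring
  im-part : ∀ a b → a Q.* 0ℚ Q.+ 0ℚ Q.* b ≡ 0ℚ
  im-part = solve-∀ ℚ-ring

toℚᵘ-ιℚ : ∀ n → toℚᵘ (ιℚ n) Qᵘ.≃ mkℚᵘ (ℤ.+ n) 0
toℚᵘ-ιℚ zero    = Qᵘ.≃-refl
toℚᵘ-ιℚ (suc n) =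
  Qᵘ.≃-trans (Q.toℚᵘ-homo-+ 1ℚ (ιℚ n)) (Qᵘ.≃-trans (Qᵘ.+-congʳ (toℚᵘ 1ℚ) (toℚᵘ-ιℚ n)) (*≡* (one-plus (ℤ.+ n))))
  where
  one-plus : ∀ z → (ℤ.1ℤ ℤ.* ℤ.1ℤ ℤ.+ z ℤ.* ℤ.1ℤ) ℤ.* ℤ.1ℤ ≡ (ℤ.1ℤ ℤ.+ z) ℤ.* (ℤ.1ℤ ℤ.* ℤ.1ℤ)
  one-plus = ℤ-Solver.solve-∀

clear-denominatorℚ : ∀ q → ∃[ d ] ∃[ P ] ∃[ M ] ιℚ (suc d) Q.* q ≡ ιℚ P Q.- ιℚ M
clear-denominatorℚ q@(mkℚ num d _) = d , P , M , Q.toℚᵘ-injective (Qᵘ.≃-trans cancelled (Qᵘ.≃-sym difference))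
  where
  positive-part negative-part : ℤ → ℕ
  positive-part (ℤ.+ n)  = n
  positive-part -[1+ n ] = 0
  negative-part (ℤ.+ n)  = 0
  negative-part -[1+ n ] = suc n
  P M : ℕ
  P = positive-part num
  M = negative-part num
  cancel : (ℤ.+ suc d ℤ.* num) ℤ.* ℤ.1ℤ ≡ num ℤ.* ℤ.+ (1 ℕ.* suc d)
  cancel = trans (ℤ.*-identityʳ _) (trans (ℤ.*-comm (ℤ.+ suc d) num) (cong (λ n → num ℤ.* ℤ.+ n) (sym (ℕ.*-identityˡ (suc d)))))
  cancelled : toℚᵘ (ιℚ (suc d) Q.* q) Qᵘ.≃ mkℚᵘ num 0
  cancelled = Qᵘ.≃-trans (Q.toℚᵘ-homo-* (ιℚ (suc d)) q) (Qᵘ.≃-trans (Qᵘ.*-congʳ (toℚᵘ-ιℚ (suc d))) (*≡* cancel))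
  split : ∀ z → mkℚᵘ (ℤ.+ positive-part z) 0 Qᵘ.+ Qᵘ.- mkℚᵘ (ℤ.+ negative-part z) 0 Qᵘ.≃ mkℚᵘ z 0
  split (ℤ.+ n)  = *≡* (nonnegative (ℤ.+ n))
    where
    nonnegative : ∀ z → (z ℤ.* ℤ.1ℤ ℤ.+ ℤ.0ℤ ℤ.* ℤ.1ℤ) ℤ.* ℤ.1ℤ ≡ z ℤ.* (ℤ.1ℤ ℤ.* ℤ.1ℤ)
    nonnegative = ℤ-Solver.solve-∀
  split -[1+ n ] = *≡* (nonpositive -[1+ n ])
    where
    nonpositive : ∀ z → (ℤ.0ℤ ℤ.* ℤ.1ℤ ℤ.+ z ℤ.* ℤ.1ℤ) ℤ.* ℤ.1ℤ ≡ z ℤ.* (ℤ.1ℤ ℤ.* ℤ.1ℤ)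
    nonpositive = ℤ-Solver.solve-∀
  difference : toℚᵘ (ιℚ P Q.- ιℚ M) Qᵘ.≃ mkℚᵘ num 0
  difference = Qᵘ.≃-trans (Q.toℚᵘ-homo-+ (ιℚ P) (Q.- ιℚ M))
    (Qᵘ.≃-trans (Qᵘ.+-cong (toℚᵘ-ιℚ P) (Qᵘ.≃-trans (Q.toℚᵘ-homo‿- (ιℚ M)) (Qᵘ.-‿cong (toℚᵘ-ιℚ M)))) (split num))

Cleared : ℚ → Set
Cleared q = ∃[ d ] ∃[ P ] ∃[ M ] ι (suc d) * ρ q ≡ ι P - ι M

clear-denominator : ∀ q → Cleared q
clear-denominator q with clear-denominatorℚ q
... | d , P , M , d*q≡P-M = d , P , M , (begin
  ι (suc d) * ρ q         ≡⟨ cong (_* ρ q) (ρ-ιℚ (suc d)) ⟨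
  ρ (ιℚ (suc d)) * ρ q    ≡⟨ ρ-* (ιℚ (suc d)) q ⟩
  ρ (ιℚ (suc d) Q.* q)    ≡⟨ cong ρ d*q≡P-M ⟩
  ρ (ιℚ P) - ρ (ιℚ M)     ≡⟨ cong₂ _-_ (ρ-ιℚ P) (ρ-ιℚ M) ⟩
  ι P - ι M               ∎)

rational-coordinates : ∀ {δ₁ δ₂} → ¬ SameAngle δ₁ δ₂ → ∀ u → ∃[ α ] ∃[ β ] u ≡ ρ α * δ₁ + ρ β * δ₂
rational-coordinates {cplx r₁ i₁} {cplx r₂ i₂} Δ≢0 (cplx r i) =
  (r Q.* i₂ Q.- i Q.* r₂) Q.* Δ⁻¹ , (r₁ Q.* i Q.- i₁ Q.* r) Q.* Δ⁻¹ ,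
  sym (cong₂ cplx (trans (re-part r i r₁ i₁ r₂ i₂ Δ⁻¹) (cancel r)) (trans (im-part r i r₁ i₁ r₂ i₂ Δ⁻¹) (cancel i)))
  where
  Δ : ℚ
  Δ = r₁ Q.* i₂ Q.- i₁ Q.* r₂
  instance
    Δ-nonZero : Q.NonZero Δ
    Δ-nonZero = Q.≢-nonZero Δ≢0
  Δ⁻¹ : ℚ
  Δ⁻¹ = Q.1/ Δ
  cancel : ∀ a → a Q.* (Δ Q.* Δ⁻¹) ≡ a
  cancel a = trans (cong (a Q.*_) (Q.*-inverseʳ Δ)) (Q.*-identityʳ a)
  re-part : ∀ r i r₁ i₁ r₂ i₂ c →
    (r Q.* i₂ Q.- i Q.* r₂) Q.* c Q.* r₁ Q.- 0ℚ Q.* i₁ Q.+ ((r₁ Q.* i Q.- i₁ Q.* r) Q.* c Q.* r₂ Q.- 0ℚ Q.* i₂)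
    ≡ r Q.* ((r₁ Q.* i₂ Q.- i₁ Q.* r₂) Q.* c)
  re-part = solve-∀ ℚ-ring
  im-part : ∀ r i r₁ i₁ r₂ i₂ c →
    (r Q.* i₂ Q.- i Q.* r₂) Q.* c Q.* i₁ Q.+ 0ℚ Q.* r₁ Q.+ ((r₁ Q.* i Q.- i₁ Q.* r) Q.* c Q.* i₂ Q.+ 0ℚ Q.* r₂)
    ≡ i Q.* ((r₁ Q.* i₂ Q.- i₁ Q.* r₂) Q.* c)
  im-part = solve-∀ ℚ-ring

record IntegralRelation (u δ₁ δ₂ : ℚi) : Set where
  field
    d P₁ M₁ P₂ M₂ : ℕ
    relation : ι (suc d) * u ≡ (ι P₁ - ι M₁) * δ₁ + (ι P₂ - ι M₂) * δ₂

common-denominator : ∀ {u δ₁ δ₂ α β} → u ≡ ρ α * δ₁ + ρ β * δ₂ → Cleared α → Cleared β → IntegralRelation u δ₁ δ₂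
common-denominator {u} {δ₁} {δ₂} {α} {β} u≡αδ₁+βδ₂ (d₁ , P , M , α-clear) (d₂ , P′ , M′ , β-clear) = record
  { d = d₂ ℕ.+ d₁ ℕ.* suc d₂ -- so that suc d is definitionally suc d₁ ℕ.* suc d₂
  ; P₁ = suc d₂ ℕ.* P ; M₁ = suc d₂ ℕ.* M ; P₂ = suc d₁ ℕ.* P′ ; M₂ = suc d₁ ℕ.* M′
  ; relation = begin
      ι (suc d₁ ℕ.* suc d₂) * u
        ≡⟨ cong₂ _*_ (ι-* (suc d₁) (suc d₂)) u≡αδ₁+βδ₂ ⟩
      e₁ * e₂ * (ρ α * δ₁ + ρ β * δ₂)
        ≡⟨ distribute e₁ e₂ (ρ α) (ρ β) δ₁ δ₂ ⟩
      e₂ * (e₁ * ρ α) * δ₁ + e₁ * (e₂ * ρ β) * δ₂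
        ≡⟨ cong₂ (λ a b → e₂ * a * δ₁ + e₁ * b * δ₂) α-clear β-clear ⟩
      e₂ * (ι P - ι M) * δ₁ + e₁ * (ι P′ - ι M′) * δ₂
        ≡⟨ distribute′ e₁ e₂ (ι P) (ι M) (ι P′) (ι M′) δ₁ δ₂ ⟩
      (e₂ * ι P - e₂ * ι M) * δ₁ + (e₁ * ι P′ - e₁ * ι M′) * δ₂
        ≡⟨ cong₂ (λ a b → a * δ₁ + b * δ₂) (cong₂ _-_ (ι-* (suc d₂) P) (ι-* (suc d₂) M))
                                          (cong₂ _-_ (ι-* (suc d₁) P′) (ι-* (suc d₁) M′)) ⟨
      (ι (suc d₂ ℕ.* P) - ι (suc d₂ ℕ.* M)) * δ₁ + (ι (suc d₁ ℕ.* P′) - ι (suc d₁ ℕ.* M′)) * δ₂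
        ∎
  }
  where
  e₁ e₂ : ℚi
  e₁ = ι (suc d₁)
  e₂ = ι (suc d₂)
  distribute : ∀ e₁ e₂ a b δ₁ δ₂ → e₁ * e₂ * (a * δ₁ + b * δ₂) ≡ e₂ * (e₁ * a) * δ₁ + e₁ * (e₂ * b) * δ₂
  distribute = solve-∀ ℚi-ring
  distribute′ : ∀ e₁ e₂ p m p′ m′ δ₁ δ₂ →
    e₂ * (p - m) * δ₁ + e₁ * (p′ - m′) * δ₂ ≡ (e₂ * p - e₂ * m) * δ₁ + (e₁ * p′ - e₁ * m′) * δ₂
  distribute′ = solve-∀ ℚi-ring

integral-relation : ∀ {δ₁ δ₂} → ¬ SameAngle δ₁ δ₂ → ∀ u → IntegralRelation u δ₁ δ₂
integral-relation Δ≢0 u = let α , β , u≡αδ₁+βδ₂ = rational-coordinates Δ≢0 u in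
  common-denominator u≡αδ₁+βδ₂ (clear-denominator α) (clear-denominator β)

-- Additive semigroups of ℚ(i) containing parabolas

IsNat : ℚi → Set
IsNat z = ∃[ n ] ι n ≡ z

IsNat⁺ : ℚi → Set
IsNat⁺ z = ∃[ n ] ι (suc n) ≡ z

nat : ∀ n → IsNat (ι n)
nat n = n , refl

nat-+ : ∀ {x y} → IsNat x → IsNat y → IsNat (x + y)
nat-+ (m , refl) (n , refl) = m ℕ.+ n , ι-+ m n

nat-* : ∀ {x y} → IsNat x → IsNat y → IsNat (x * y)
nat-* (m , refl) (n , refl) = m ℕ.* n , ι-* m n

nat⁺-1+ : ∀ {x} → IsNat x → IsNat⁺ (1ᵢ + x)
nat⁺-1+ (n , refl) = n , refl

module Multiplicities (e₀ p₁ m₁ p₂ m₂ : ℚi) where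

  ν L₁ L₂ A B C D : ℚi
  ν  = 1ᵢ + (p₁ + m₁ + (p₂ + m₂))
  L₁ = e₀ + (p₂ + m₂) * (1ᵢ + e₀) + (p₁ + m₁) * e₀
  L₂ = e₀ + (p₁ + m₁) * (1ᵢ + e₀) + (p₂ + m₂) * e₀
  A  = 1ᵢ + (L₁ + (m₁ + m₁))
  B  = 1ᵢ + (L₁ + (p₁ + p₁))
  C  = 1ᵢ + (L₂ + (m₂ + m₂))
  D  = 1ᵢ + (L₂ + (p₂ + p₂))

  -- Since 1 + L₁ = (1 + e₀)ν − p₁ − m₁ and 1 + L₂ = (1 + e₀)ν − p₂ − m₂, the multiplicities satisfy
  -- A + B = C + D = 2(1 + e₀)ν, A − B = 2(m₁ − p₁) and C − D = 2(m₂ − p₂); so the left side is 2ν²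
  -- times the defect of the relation (1 + e₀)(u₁ + u₂) = (p₁ − m₁)δ₁ + (p₂ − m₂)δ₂.
  parabola-combination : ∀ u₁ u₂ δ₁ δ₂ →
    A * (ν * u₁ + ν * ν * δ₁) + B * (ν * u₁ + ν * ν * - δ₁) + (C * (ν * u₂ + ν * ν * δ₂) + D * (ν * u₂ + ν * ν * - δ₂))
    ≡ ν * ν * (1ᵢ + 1ᵢ) * ((1ᵢ + e₀) * (u₁ + u₂) - ((p₁ - m₁) * δ₁ + (p₂ - m₂) * δ₂))
  parabola-combination = expanded e₀ p₁ m₁ p₂ m₂
    where
    expanded : ∀ e₀ p₁ m₁ p₂ m₂ u₁ u₂ δ₁ δ₂ →
      let ν  = 1ᵢ + (p₁ + m₁ + (p₂ + m₂))
          L₁ = e₀ + (p₂ + m₂) * (1ᵢ + e₀) + (p₁ + m₁) * e₀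
          L₂ = e₀ + (p₁ + m₁) * (1ᵢ + e₀) + (p₂ + m₂) * e₀
      in (1ᵢ + (L₁ + (m₁ + m₁))) * (ν * u₁ + ν * ν * δ₁) + (1ᵢ + (L₁ + (p₁ + p₁))) * (ν * u₁ + ν * ν * - δ₁)
         + ((1ᵢ + (L₂ + (m₂ + m₂))) * (ν * u₂ + ν * ν * δ₂) + (1ᵢ + (L₂ + (p₂ + p₂))) * (ν * u₂ + ν * ν * - δ₂))
         ≡ ν * ν * (1ᵢ + 1ᵢ) * ((1ᵢ + e₀) * (u₁ + u₂) - ((p₁ - m₁) * δ₁ + (p₂ - m₂) * δ₂))
    expanded = solve-∀ ℚi-ring

  module Positivity (e₀-nat : IsNat e₀) (p₁-nat : IsNat p₁) (m₁-nat : IsNat m₁) (p₂-nat : IsNat p₂) (m₂-nat : IsNat m₂) where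

    ν⁺ : IsNat⁺ ν
    ν⁺ = nat⁺-1+ (nat-+ (nat-+ p₁-nat m₁-nat) (nat-+ p₂-nat m₂-nat))

    L₁-nat : IsNat L₁
    L₁-nat = nat-+ (nat-+ e₀-nat (nat-* (nat-+ p₂-nat m₂-nat) (nat-+ (nat 1) e₀-nat))) (nat-* (nat-+ p₁-nat m₁-nat) e₀-nat)

    L₂-nat : IsNat L₂
    L₂-nat = nat-+ (nat-+ e₀-nat (nat-* (nat-+ p₁-nat m₁-nat) (nat-+ (nat 1) e₀-nat))) (nat-* (nat-+ p₂-nat m₂-nat) e₀-nat)

    A⁺ : IsNat⁺ A
    A⁺ = nat⁺-1+ (nat-+ L₁-nat (nat-+ m₁-nat m₁-nat))

    B⁺ : IsNat⁺ B
    B⁺ = nat⁺-1+ (nat-+ L₁-nat (nat-+ p₁-nat p₁-nat))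

    C⁺ : IsNat⁺ C
    C⁺ = nat⁺-1+ (nat-+ L₂-nat (nat-+ m₂-nat m₂-nat))

    D⁺ : IsNat⁺ D
    D⁺ = nat⁺-1+ (nat-+ L₂-nat (nat-+ p₂-nat p₂-nat))

ContainsParabolas : (ℚi → Set) → ℚi → ℚi → Set
ContainsParabolas S u δ = ∀ {ν} → IsNat⁺ ν → S (ν * u + ν * ν * δ) × S (ν * u + ν * ν * - δ)

module AdditiveClosure (S : ℚi → Set) (S-+ : ∀ {x y} → S x → S y → S (x + y)) where

  S-scale : ∀ {μ x} → IsNat⁺ μ → S x → S (μ * x)
  S-scale {x = x} (zero  , refl) x∈S = subst S (sym (one x)) x∈S
    where
    one : ∀ x → (1ᵢ + 0ᵢ) * x ≡ x
    one = solve-∀ ℚi-ring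
  S-scale {x = x} (suc m , refl) x∈S = subst S (step (ι (suc m)) x) (S-+ x∈S (S-scale (m , refl) x∈S))
    where
    step : ∀ μ x → x + μ * x ≡ (1ᵢ + μ) * x
    step = solve-∀ ℚi-ring

  0∈S-from-relation : ∀ {u₁ u₂ δ₁ δ₂} → IntegralRelation (u₁ + u₂) δ₁ δ₂ →
                      ContainsParabolas S u₁ δ₁ → ContainsParabolas S u₂ δ₂ → S 0ᵢ
  0∈S-from-relation {u₁} {u₂} {δ₁} {δ₂} r S₁ S₂ =
    subst S (trans (parabola-combination u₁ u₂ δ₁ δ₂) (defect-vanishes (ν * ν * (1ᵢ + 1ᵢ)) relation))
      (S-+ (S-+ (S-scale A⁺ (proj₁ (S₁ ν⁺))) (S-scale B⁺ (proj₂ (S₁ ν⁺))))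
           (S-+ (S-scale C⁺ (proj₁ (S₂ ν⁺))) (S-scale D⁺ (proj₂ (S₂ ν⁺)))))
    where
    open IntegralRelation r
    open Multiplicities (ι d) (ι P₁) (ι M₁) (ι P₂) (ι M₂)
    open Positivity (nat d) (nat P₁) (nat M₁) (nat P₂) (nat M₂)
    defect-vanishes : ∀ c {a b} → a ≡ b → c * (a - b) ≡ 0ᵢ
    defect-vanishes c {b = b} refl = annihilate c b
      where
      annihilate : ∀ c b → c * (b - b) ≡ 0ᵢ
      annihilate = solve-∀ ℚi-ring

  0∈S : ∀ {u₁ u₂ δ₁ δ₂} → ¬ SameAngle δ₁ δ₂ → ContainsParabolas S u₁ δ₁ → ContainsParabolas S u₂ δ₂ → S 0ᵢ
  0∈S {u₁} {u₂} Δ≢0 = 0∈S-from-relation (integral-relation Δ≢0 (u₁ + u₂))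

-- The semigroup ⟨G⟩

module Semigroup {k t : ℕ} (G : Fin t → Mat (suc (suc k))) (G∈H : ∀ i → IsH k (G i)) where

  val : List (Fin t) → Heis k
  val []      = ε
  val (i ∷ w) = ψ (G i) · val w

  val-++ : ∀ u v → val (u ++ v) ≈ val u · val v
  val-++ []      v = ≈-sym (·-identityˡ (val v))
  val-++ (i ∷ u) v =
    ≈-trans (·-cong (≈-refl {s = ψ (G i)}) (val-++ u v)) (≈-sym (·-assoc (ψ (G i)) (val u) (val v)))

  vec-val-++ : ∀ u v κ → vec (val (u ++ v)) κ ≡ vec (val u) κ + vec (val v) κ
  vec-val-++ u v κ = trans (proj₁ (val-++ u v) κ) (vec-· (val u) (val v) κ)

  prodList≈val : ∀ i w → prodList (G i) (List.map G w) ≈M toMat (val (i ∷ w))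
  prodList≈val i []      = ≈M-trans (toMat-ψ (G∈H i)) (toMat-cong (≈-sym (·-identityʳ (ψ (G i)))))
  prodList≈val i (j ∷ w) =
    ≈M-trans (*M-cong (toMat-ψ (G∈H i)) (prodList≈val j w)) (toMat-· (ψ (G i)) (val (j ∷ w)))

  Reachable : Heis k → Set
  Reachable s = Σ[ w ∈ List⁺ (Fin t) ] val (toList w) ≈ s

  reachable-≈ : ∀ {s s′} → Reachable s → s ≈ s′ → Reachable s′
  reachable-≈ (w , w≈s) s≈s′ = w , ≈-trans w≈s s≈s′

  reachable-· : ∀ {s s′} → Reachable s → Reachable s′ → Reachable (s · s′)
  reachable-· (w , w≈s) (w′ , w′≈s′) = w ⁺++⁺ w′ , ≈-trans (val-++ (toList w) (toList w′)) (·-cong w≈s w′≈s′)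

  reachable-^ : ∀ {x} → Reachable x → ∀ n → Reachable (x ^ suc n)
  reachable-^ {x} x-reachable zero    = reachable-≈ x-reachable (≈-sym (·-identityʳ x))
  reachable-^     x-reachable (suc n) = reachable-· x-reachable (reachable-^ x-reachable n)

  reachable-ε : Reachable ε → In⟨ G ⟩ Iₙ
  reachable-ε ((i ∷ w) , w≈ε) = (i ∷ w) , ≈M-trans (prodList≈val i w) (≈M-trans (toMat-cong w≈ε) toMat-ε)

  record InvertibleModΩ (x : Heis k) : Set where
    field
      reachable : Reachable x
      inverse : Heis k
      inverse-reachable : Reachable inverse
      inverse-Ω : IsΩ (x · inverse)

    defect : ℚi
    defect = m₃ (x · inverse)
  open InvertibleModΩ

  -- With w = L i R, the inverse w R L is non-empty, and x (w R L) has the linear part of w twice.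
  nonRedundant⇒invertibleModΩ : ∀ {i} → NonRedundant G i → InvertibleModΩ (ψ (G i))
  nonRedundant⇒invertibleModΩ {i} (w@(h ∷ tl) , i∈w , w∈Ω) with ∈-∃++ i∈w
  ... | L , R , w≡L++i∷R = record
    { reachable = (i ∷ []) , ·-identityʳ x
    ; inverse = val (toList w ++ (R ++ L))
    ; inverse-reachable = w ⁺++ (R ++ L) , ≈-refl
    ; inverse-Ω = λ κ → begin
        vec (x · val (toList w ++ (R ++ L))) κ
          ≡⟨ trans (vec-· x _ κ) (cong (vec x κ +_)
               (trans (vec-val-++ (toList w) (R ++ L) κ) (cong (vec W κ +_) (vec-val-++ R L κ)))) ⟩
        vec x κ + (vec W κ + (vec (val R) κ + vec (val L) κ))
          ≡⟨ rotate (vec x κ) (vec W κ) (vec (val R) κ) (vec (val L) κ) ⟩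
        vec W κ + (vec (val L) κ + (vec x κ + vec (val R) κ))
          ≡⟨ cong₂ _+_ (W∈Ω κ) (trans (sym (rotated κ)) (W∈Ω κ)) ⟩
        0ᵢ + 0ᵢ
          ≡⟨ +-identityʳ 0ᵢ ⟩
        0ᵢ ∎
    }
    where
    x W : Heis k
    x = ψ (G i)
    W = val (toList w)
    W∈Ω : IsΩ W
    W∈Ω = InΩ⇒IsΩ (prodList≈val h tl) w∈Ω
    rotated : ∀ κ → vec W κ ≡ vec (val L) κ + (vec x κ + vec (val R) κ)
    rotated κ = trans (cong (λ u → vec (val u) κ) w≡L++i∷R)
                      (trans (vec-val-++ L (i ∷ R) κ) (cong (vec (val L) κ +_) (vec-· x (val R) κ)))
    rotate : ∀ a b c d → a + (b + (c + d)) ≡ b + (d + (a + c))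
    rotate = solve-∀ ℚi-ring

  ΩValue : ℚi → Set
  ΩValue z = Σ[ s ∈ Heis k ] Reachable s × IsΩ s × m₃ s ≡ z

  ΩValue-+ : ∀ {z z′} → ΩValue z → ΩValue z′ → ΩValue (z + z′)
  ΩValue-+ (s , s-reachable , s∈Ω , refl) (s′ , s′-reachable , s′∈Ω , refl) =
    s · s′ , reachable-· s-reachable s′-reachable , Ω-· s∈Ω s′∈Ω , m₃-Ω-· s′ s∈Ω

  ΩValue-0 : ΩValue 0ᵢ → In⟨ G ⟩ Iₙ
  ΩValue-0 (s , s-reachable , s∈Ω , m₃≡0) = reachable-ε (reachable-≈ s-reachable (Ω-≈ε s∈Ω m₃≡0))

  ΩValue-block : ∀ {x y} (x⁻ : InvertibleModΩ x) (y⁻ : InvertibleModΩ y) n →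
    ΩValue (ι (suc n) * (defect x⁻ + defect y⁻) + ι (suc n) * ι (suc n) * (β x y - β y x))
  ΩValue-block {x} {y} x⁻ y⁻ n =
    block x y (inverse x⁻) (inverse y⁻) (suc n) ,
    reachable-· (power (reachable x⁻)) (reachable-· (power (reachable y⁻))
      (reachable-· (power (inverse-reachable x⁻)) (power (inverse-reachable y⁻)))) ,
    block-Ω X∼x Y∼y (suc n) ,
    block-m₃ X∼x Y∼y (suc n)
    where
    power : ∀ {z} → Reachable z → Reachable (z ^ suc n)
    power z-reachable = reachable-^ z-reachable n
    X∼x : inverse x⁻ ∼[ - 1ᵢ ] x
    X∼x = inverse-mod-Ω {x = x} (inverse-Ω x⁻)
    Y∼y : inverse y⁻ ∼[ - 1ᵢ ] y
    Y∼y = inverse-mod-Ω {x = y} (inverse-Ω y⁻)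

  parabolas : ∀ {x y} (x⁻ : InvertibleModΩ x) (y⁻ : InvertibleModΩ y) →
              ContainsParabolas ΩValue (defect x⁻ + defect y⁻) (β x y - β y x)
  parabolas {x} {y} x⁻ y⁻ (n , refl) =
    ΩValue-block x⁻ y⁻ n ,
    subst ΩValue (swap (ι (suc n)) (defect x⁻) (defect y⁻) (β x y) (β y x)) (ΩValue-block y⁻ x⁻ n)
    where
    swap : ∀ ν a b p q → ν * (b + a) + ν * ν * (q - p) ≡ ν * (a + b) + ν * ν * - (p - q)
    swap = solve-∀ ℚi-ring

lemma5 : (k t : ℕ) (G : Fin t → Mat (suc (suc k)))
    → (∀ i → IsH k (G i))
    → (∀ i → NonRedundant G i)
    → (p q r s : Fin t)
    → ¬ SameAngle (comm (G p) (G q)) (comm (G r) (G s))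
    → In⟨ G ⟩ Iₙ
lemma5 k t G G∈H nonRedundant p q r s Δ≢0 =
  ΩValue-0 (0∈S Δ≢0 (parabolas (invertible p) (invertible q)) (parabolas (invertible r) (invertible s)))
  where
  open Semigroup G G∈H
  open AdditiveClosure ΩValue ΩValue-+
  invertible : ∀ i → InvertibleModΩ (ψ (G i))
  invertible i = nonRedundant⇒invertibleModΩ (nonRedundant i)
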